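{- Let $I=(G,T,p)$ be an instance of Directed Vertex Multiway Cut and $Z\subseteq V(G)\setminus T$. Let $I/Z=(G',T,p)$ where $G'=\mathrm{torso}(G,V(G)\setminus Z)$. Then: (1) if $S$ is a solution for $I/Z$, then $S$ is also a solution for $I$; (2) if $S$ is a solution for $I$ such that $f_{G,T}(S)\cup r_{G,T}(S)\subseteq Z$ and $S\cap Z=\emptyset$, then $S$ is a shadowless solution for $I/Z$, i.e. a solution for $I/Z$ with $f_{G',T}(S)=r_{G',T}(S)=\emptyset$.
   Context: An instance $(G,T,p)$ of Directed Vertex Multiway Cut consists of a directed graph $G$, terminals $T\subseteq V(G)$, distinguished vertices $V^{\infty}(G)\supseteq T$ and an integer $p$; a solution is $S\subseteq V(G)\setminus V^{\infty}(G)$ with $|S|\le p$ such that $G\setminus S$ has no directed path between distinct terminals. In $I/Z$ the distinguished vertices are those of $V^{\infty}(G)$ that lie in $V(G)\setminus Z$. For $C\subseteq V(G)$, $\mathrm{torso}(G,C)$ has vertex set $C$ and a directed edge $(a,b)$ whenever $G$ has an $a\to b$ path whose internal vertices are not in $C$. For disjoint nonempty $X,Y$, an $X-Y$ separator in a graph $H$ is a set $S\subseteq V(H)\setminus(X\cup Y\cup V^{\infty}(H))$ such that $H\setminus S$ has no directed path from $X$ to $Y$. The forward shadow $f_{H,T}(S)$ is the set of $v$ such that $S$ is a $T-\{v\}$ separator in $H$, and the reverse shadow $r_{H,T}(S)$ is the set of $v$ such that $S$ is a $\{v\}-T$ separator in $H$. -}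

module Defs where

open import Data.Nat using (ℕ; _≤_)
open import Data.Fin using (Fin)
open import Data.Fin.Subset using (Subset; _∈_; _∉_; _⊆_; ⁅_⁆; ⊤; ∁; _∩_; ∣_∣; Nonempty)
open import Data.Product using (_×_)
open import Relation.Nullary using (¬_)
open import Relation.Binary.PropositionalEquality using (_≢_)

record Digraph (n : ℕ) : Set₁ where
  field
    V : Subset n
    E : Fin n → Fin n → Set
open Digraph public

fullGraph : ∀ {n} → (Fin n → Fin n → Set) → Digraph n
fullGraph E = record { V = ⊤ ; E = E }

data PathAvoid {n} (H : Digraph n) (S : Subset n) : Fin n → Fin n → Set where
  stop : ∀ {v} → v ∈ V H → v ∉ S → PathAvoid H S v v
  cons : ∀ {u w v} → u ∈ V H → u ∉ S → E H u w → PathAvoid H S w v → PathAvoid H S u v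

data InternalPath {n} (E : Fin n → Fin n → Set) (P : Fin n → Set) : Fin n → Fin n → Set where
  edge : ∀ {a b} → E a b → InternalPath E P a b
  step : ∀ {a w b} → E a w → P w → InternalPath E P w b → InternalPath E P a b

torso : ∀ {n} → Digraph n → Subset n → Digraph n
torso G C = record
  { V = C
  ; E = λ a b → a ∈ C × b ∈ C × InternalPath (E G) (λ w → w ∉ C) a b }

Solution : ∀ {n} → Digraph n → (T Vinf : Subset n) → ℕ → Subset n → Set
Solution H T Vinf p S =
  S ⊆ V H ×
  (∀ v → v ∈ S → v ∉ Vinf) ×
  ∣ S ∣ ≤ p ×
  (∀ t t′ → t ∈ T → t′ ∈ T → t ≢ t′ → ¬ PathAvoid H S t t′)

Separator : ∀ {n} → Digraph n → (Vinf : Subset n) → (X Y S : Subset n) → Set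
Separator H Vinf X Y S =
  Nonempty X × Nonempty Y × (∀ v → v ∈ X → v ∉ Y) ×
  S ⊆ V H ×
  (∀ v → v ∈ S → v ∉ X × v ∉ Y × v ∉ Vinf) ×
  (∀ x y → x ∈ X → y ∈ Y → ¬ PathAvoid H S x y)

ForwardShadow : ∀ {n} → Digraph n → (Vinf T S : Subset n) → Fin n → Set
ForwardShadow H Vinf T S v = v ∈ V H × Separator H Vinf T ⁅ v ⁆ S

ReverseShadow : ∀ {n} → Digraph n → (Vinf T S : Subset n) → Fin n → Set
ReverseShadow H Vinf T S v = v ∈ V H × Separator H Vinf ⁅ v ⁆ T S

module Submission where

-- Let G be the full graph on Fin n and G' = torso(G, C).  The whole lemma
-- rests on two path-transfer facts:
--   * contraction: a path of G ∖ S between two vertices of C yields a path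
--     of G' ∖ S (collapse every maximal stretch outside C into a torso edge);
--   * expansion: if S ⊆ C, a path of G' ∖ S yields a path of G ∖ S
--     (unfold every torso edge into its internal path, which lies outside C
--     and hence avoids S).
-- From these we get that solutions of the torso are solutions of G
-- (contraction, terminals lie in C), that solutions of G inside C are
-- solutions of the torso (expansion), and that separators and hence
-- forward/reverse shadows of the torso are separators/shadows of G
-- (contraction).  The theorem lemma5 is the case C = ∁ Z: a shadow vertex of
-- the torso would be a shadow vertex of G, hence in Z, but it lies in ∁ Z.

open import Defs
open import Data.Nat using (ℕ)
open import Data.Fin using (Fin)
open import Data.Fin.Subset using (Subset; _∈_; _∉_; _⊆_; ⁅_⁆; ∁; _∩_)
open import Data.Fin.Subset.Properties
  using (_∈?_; ∈⊤; x∈⁅y⁆⇒x≡y; x∈p∩q⁺; x∈p∩q⁻; x∉p⇒x∈∁p; x∈∁p⇒x∉p)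
open import Data.Product using (_×_; _,_; proj₁)
open import Data.Sum using (_⊎_; inj₁; inj₂)
open import Relation.Nullary using (¬_; yes; no)
open import Relation.Binary.PropositionalEquality using (refl)

⁅⁆⊆ : ∀ {n} {C : Subset n} {v : Fin n} → v ∈ C → ⁅ v ⁆ ⊆ C
⁅⁆⊆ {v = v} v∈C x∈⁅v⁆ with x∈⁅y⁆⇒x≡y v x∈⁅v⁆
... | refl = v∈C

module PathTransfer {n} (E : Fin n → Fin n → Set) (C S : Subset n) where

  G : Digraph n
  G = fullGraph E

  G′ : Digraph n
  G′ = torso G C

  Outside : Fin n → Set
  Outside w = w ∉ C

  snoc : ∀ {a w b} → InternalPath E Outside a w → Outside w → E w b →
         InternalPath E Outside a b
  snoc (edge e)        w∉C e′ = step e w∉C (edge e′)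
  snoc (step e x∉C ip) w∉C e′ = step e x∉C (snoc ip w∉C e′)

  -- The pending path grows while the G-path stays outside C and is closed
  -- into a torso edge at the first vertex back in C.
  contract-from : ∀ {a w v} → a ∈ C → a ∉ S → InternalPath E Outside a w →
                  PathAvoid G S w v → v ∈ C → PathAvoid G′ S a v
  contract-from a∈C a∉S ip (stop _ v∉S) v∈C =
    cons a∈C a∉S (a∈C , v∈C , ip) (stop v∈C v∉S)
  contract-from {w = w} a∈C a∉S ip (cons _ w∉S e rest) v∈C with w ∈? C
  ... | yes w∈C = cons a∈C a∉S (a∈C , w∈C , ip)
                    (contract-from w∈C w∉S (edge e) rest v∈C)
  ... | no  w∉C = contract-from a∈C a∉S (snoc ip w∉C e) rest v∈C

  contract : ∀ {u v} → PathAvoid G S u v → u ∈ C → v ∈ C → PathAvoid G′ S u v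
  contract (stop _ u∉S)        u∈C v∈C = stop u∈C u∉S
  contract (cons _ u∉S e rest) u∈C v∈C = contract-from u∈C u∉S (edge e) rest v∈C

  module _ (S⊆C : S ⊆ C) where

    -- Unfolding one torso edge: its internal vertices are outside C ⊇ S.
    expand-edge : ∀ {a b v} → InternalPath E Outside a b → a ∉ S →
                  PathAvoid G S b v → PathAvoid G S a v
    expand-edge (edge e)        a∉S rest = cons ∈⊤ a∉S e rest
    expand-edge (step e w∉C ip) a∉S rest =
      cons ∈⊤ a∉S e (expand-edge ip (λ w∈S → w∉C (S⊆C w∈S)) rest)

    expand : ∀ {u v} → PathAvoid G′ S u v → PathAvoid G S u v
    expand (stop _ u∉S)                   = stop ∈⊤ u∉S
    expand (cons _ u∉S (_ , _ , ip) rest) = expand-edge ip u∉S (expand rest)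

open PathTransfer using (contract; expand)

module _ {n} (E : Fin n → Fin n → Set) (C : Subset n) (Vinf : Subset n) where

  private
    G  = fullGraph E
    G′ = torso G C

  solution-from-torso : ∀ {T p S} → T ⊆ C →
    Solution G′ T (Vinf ∩ C) p S → Solution G T Vinf p S
  solution-from-torso T⊆C (S⊆C , S∉Vinf′ , size , cuts) =
    (λ _ → ∈⊤) ,
    (λ v v∈S v∈Vinf → S∉Vinf′ v v∈S (x∈p∩q⁺ (v∈Vinf , S⊆C v∈S))) ,
    size ,
    (λ t t′ t∈T t′∈T t≢t′ path →
       cuts t t′ t∈T t′∈T t≢t′ (contract E C _ path (T⊆C t∈T) (T⊆C t′∈T)))

  solution-to-torso : ∀ {T p S} → S ⊆ C →
    Solution G T Vinf p S → Solution G′ T (Vinf ∩ C) p S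
  solution-to-torso S⊆C (_ , S∉Vinf , size , cuts) =
    S⊆C ,
    (λ v v∈S v∈Vinf′ → S∉Vinf v v∈S (proj₁ (x∈p∩q⁻ Vinf C v∈Vinf′))) ,
    size ,
    (λ t t′ t∈T t′∈T t≢t′ path →
       cuts t t′ t∈T t′∈T t≢t′ (expand E C _ S⊆C path))

  separator-from-torso : ∀ {X Y S} → X ⊆ C → Y ⊆ C →
    Separator G′ (Vinf ∩ C) X Y S → Separator G Vinf X Y S
  separator-from-torso X⊆C Y⊆C (X≠∅ , Y≠∅ , disjoint , S⊆C , S-ok , cuts) =
    X≠∅ , Y≠∅ , disjoint , (λ _ → ∈⊤) ,
    (λ v v∈S → let (v∉X , v∉Y , v∉Vinf′) = S-ok v v∈S in
       v∉X , v∉Y , (λ v∈Vinf → v∉Vinf′ (x∈p∩q⁺ (v∈Vinf , S⊆C v∈S)))) ,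
    (λ x y x∈X y∈Y path → cuts x y x∈X y∈Y (contract E C _ path (X⊆C x∈X) (Y⊆C y∈Y)))

  forward-shadow-from-torso : ∀ {T S v} → T ⊆ C →
    ForwardShadow G′ (Vinf ∩ C) T S v → ForwardShadow G Vinf T S v
  forward-shadow-from-torso T⊆C (v∈C , sep) =
    ∈⊤ , separator-from-torso T⊆C (⁅⁆⊆ v∈C) sep

  reverse-shadow-from-torso : ∀ {T S v} → T ⊆ C →
    ReverseShadow G′ (Vinf ∩ C) T S v → ReverseShadow G Vinf T S v
  reverse-shadow-from-torso T⊆C (v∈C , sep) =
    ∈⊤ , separator-from-torso (⁅⁆⊆ v∈C) T⊆C sep

lemma5 : ∀ {n} (E : Fin n → Fin n → Set) (T Vinf : Subset n) (p : ℕ) →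
    T ⊆ Vinf →
    (Z : Subset n) → (∀ v → v ∈ Z → v ∉ T) →
    ((S : Subset n) →
      Solution (torso (fullGraph E) (∁ Z)) T (Vinf ∩ ∁ Z) p S →
      Solution (fullGraph E) T Vinf p S)
    ×
    ((S : Subset n) →
      Solution (fullGraph E) T Vinf p S →
      (∀ v → ForwardShadow (fullGraph E) Vinf T S v ⊎ ReverseShadow (fullGraph E) Vinf T S v → v ∈ Z) →
      (∀ v → v ∈ S → v ∉ Z) →
      Solution (torso (fullGraph E) (∁ Z)) T (Vinf ∩ ∁ Z) p S
      × (∀ v → ¬ ForwardShadow (torso (fullGraph E) (∁ Z)) (Vinf ∩ ∁ Z) T S v)
      × (∀ v → ¬ ReverseShadow (torso (fullGraph E) (∁ Z)) (Vinf ∩ ∁ Z) T S v))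
lemma5 E T Vinf _ _ Z Z∩T=∅ =
  (λ _ → solution-from-torso E (∁ Z) Vinf T⊆∁Z) ,
  λ S sol shadows⊆Z S∩Z=∅ →
    let S⊆∁Z : S ⊆ ∁ Z
        S⊆∁Z {v} v∈S = x∉p⇒x∈∁p (S∩Z=∅ v v∈S)
    in solution-to-torso E (∁ Z) Vinf S⊆∁Z sol ,
       (λ v fwd → x∈∁p⇒x∉p (proj₁ fwd)
          (shadows⊆Z v (inj₁ (forward-shadow-from-torso E (∁ Z) Vinf T⊆∁Z fwd)))) ,
       (λ v rev → x∈∁p⇒x∉p (proj₁ rev)
          (shadows⊆Z v (inj₂ (reverse-shadow-from-torso E (∁ Z) Vinf T⊆∁Z rev))))
  where
  T⊆∁Z : T ⊆ ∁ Z
  T⊆∁Z {t} t∈T = x∉p⇒x∈∁p (λ t∈Z → Z∩T=∅ t t∈Z t∈T)
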